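{- Let $W=\langle K,\le,D,J,v\rangle$ be a prevalent model, $k\in K$, and $F$ a formula context and $B$ a formula such that $F[\sim B]$ is a closed $\mathcal{L}(D)$-formula. If $k\models_WF[\sim B]$ then $k\models_WF[\neg B]$.
   Context: Language: $\mathcal{L}$ is a first-order language with $\top,\bot$, connectives $\land,\lor,\to,\neg$ ($\neg$ primitive, distinct from $A\to\bot$), $\forall,\exists$, countably many variables, constants, function and predicate symbols, including a distinguished unary predicate $E$. $\sim A$ abbreviates $A\to\bot$. $\mathcal{L}(D)$ adds constants $\overline d$ for $d\in D$. GN formulas: $N::=\bot\mid\neg A\mid N\land N\mid N\lor N\mid N\to N\mid\forall xN\mid\exists xN$; $\forall xA$/$\exists xA$ is global if $x$ occurs free in $A$ and all its free occurrences lie inside GN subformulas, local otherwise. Formula contexts: $F::=*\mid F\circ A\mid A\circ F\mid\neg F\mid\forall xF\mid\exists xF$ ($\circ\in\{\land,\lor,\to\}$, placeholder $*$ occurring once); $F[C]$ replaces $*$ by $C$ (variables of $C$ may become bound). So $F[\neg B]$ results from $F[\sim B]$ by replacing the indicated occurrence of $B\to\bot$ with $\neg B$. Strict finitistic model $W=\langle K,\le,D,J,v\rangle$: rooted tree (countable branching, height $\le\omega$), nonempty constant domain $D$, compositional interpretation $J$ of closed $\mathcal{L}(D)$-terms with $J(\overline d)=d$, monotone extensions $P^{v(k)}\subseteq D^n$, strictness (values of all subterms of arguments of an atom true at a node lie in $E$'s extension there), finite verification (finitely many predicates with nonempty extension per node). Forcing: atoms via $v(k)$; $\top$ forced, $\bot$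 not; $\land,\lor$ componentwise; $k\models A\to B$ iff every $k'\ge k$ forcing $A$ has some $k''\ge k'$ forcing $B$; $k\models\neg A$ iff no node forces $A$; $k\models\forall xA$ iff for all $d$, $k\models\top\to A[\overline d/x]$ (global) or $k\models E(\overline d)\to A[\overline d/x]$ (local); $k\models\exists xA$ iff for some $d$, $k\models A[\overline d/x]$ (global) or $k\models E(\overline d)\land A[\overline d/x]$ (local). $W$ is prevalent if every closed $\mathcal{L}(D)$-formula forced at some node is prevalent (each node has some node above-or-equal forcing it) and $E(\overline d)$ is prevalent for all $d\in D$. -}

module Defs where

open import Data.Nat using (ℕ; zero; suc; _≡ᵇ_; _⊔_)
open import Data.Bool using (Bool; true; false; _∧_; _∨_; not; if_then_else_)
open import Data.Vec using (Vec; []; _∷_)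
open import Data.List using (List)
open import Data.List.Membership.Propositional using (_∈_)
open import Data.Maybe using (Maybe; just; nothing)
open import Data.Product using (Σ; _×_; _,_)
open import Data.Sum using (_⊎_)
open import Data.Unit using (⊤)
open import Data.Empty using (⊥)
open import Relation.Binary.PropositionalEquality using (_≡_; _≢_)
open import Relation.Nullary using (¬_)

-- Signature of the language L: countably many constants (indexed by ℕ),
-- function symbols f_i of arity funAr i, predicate symbols R_i of arity
-- predAr i, plus the distinguished unary predicate E.

record Signature : Set where
  field
    funAr  : ℕ → ℕ
    predAr : ℕ → ℕ
open Signature public

data Pred (S : Signature) : Set where
  E : Pred S
  R : ℕ → Pred S

arity : {S : Signature} → Pred S → ℕ
arity E = 1
arity {S} (R i) = predAr S i

data Term (S : Signature) (D : Set) : Set where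
  var : ℕ → Term S D
  con : ℕ → Term S D
  par : D → Term S D
  fun : (i : ℕ) → Vec (Term S D) (funAr S i) → Term S D

-- Formulas of L(D); ¬ᶠ is primitive, distinct from A ⇒ᶠ botᶠ.
data Formula (S : Signature) (D : Set) : Set where
  topᶠ botᶠ : Formula S D
  atom : (p : Pred S) → Vec (Term S D) (arity p) → Formula S D
  _∧ᶠ_ _∨ᶠ_ _⇒ᶠ_ : Formula S D → Formula S D → Formula S D
  ¬ᶠ_ : Formula S D → Formula S D
  ∀ᶠ ∃ᶠ : ℕ → Formula S D → Formula S D

∼_ : {S : Signature} {D : Set} → Formula S D → Formula S D
∼ A = A ⇒ᶠ botᶠ

data BinOp : Set where
  andᵒ orᵒ impᵒ : BinOp

bin : {S : Signature} {D : Set} → BinOp → Formula S D → Formula S D → Formula S D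
bin andᵒ A B = A ∧ᶠ B
bin orᵒ  A B = A ∨ᶠ B
bin impᵒ A B = A ⇒ᶠ B

data Ctx (S : Signature) (D : Set) : Set where
  hole : Ctx S D
  binL : BinOp → Ctx S D → Formula S D → Ctx S D
  binR : BinOp → Formula S D → Ctx S D → Ctx S D
  negC : Ctx S D → Ctx S D
  allC exC : ℕ → Ctx S D → Ctx S D

-- F[C]: plain replacement of the placeholder (variables of C may be captured)
plug : {S : Signature} {D : Set} → Ctx S D → Formula S D → Formula S D
plug hole C = C
plug (binL o F A) C = bin o (plug F C) A
plug (binR o A F) C = bin o A (plug F C)
plug (negC F) C = ¬ᶠ (plug F C)
plug (allC x F) C = ∀ᶠ x (plug F C)
plug (exC x F) C = ∃ᶠ x (plug F C)

module _ {S : Signature} {D : Set} where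

  mutual
    varInT : ℕ → Term S D → Bool
    varInT x (var y) = x ≡ᵇ y
    varInT x (con _) = false
    varInT x (par _) = false
    varInT x (fun i ts) = varInTs x ts

    varInTs : {n : ℕ} → ℕ → Vec (Term S D) n → Bool
    varInTs x [] = false
    varInTs x (t ∷ ts) = varInT x t ∨ varInTs x ts

  freeIn : ℕ → Formula S D → Bool
  freeIn x topᶠ = false
  freeIn x botᶠ = false
  freeIn x (atom p ts) = varInTs x ts
  freeIn x (A ∧ᶠ B) = freeIn x A ∨ freeIn x B
  freeIn x (A ∨ᶠ B) = freeIn x A ∨ freeIn x B
  freeIn x (A ⇒ᶠ B) = freeIn x A ∨ freeIn x B
  freeIn x (¬ᶠ A) = freeIn x A
  freeIn x (∀ᶠ y A) = if x ≡ᵇ y then false else freeIn x A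
  freeIn x (∃ᶠ y A) = if x ≡ᵇ y then false else freeIn x A

  Closed : Formula S D → Set
  Closed A = (x : ℕ) → freeIn x A ≡ false

  isGN : Formula S D → Bool
  isGN topᶠ = false
  isGN botᶠ = true
  isGN (atom p ts) = false
  isGN (A ∧ᶠ B) = isGN A ∧ isGN B
  isGN (A ∨ᶠ B) = isGN A ∧ isGN B
  isGN (A ⇒ᶠ B) = isGN A ∧ isGN B
  isGN (¬ᶠ A) = true
  isGN (∀ᶠ x A) = isGN A
  isGN (∃ᶠ x A) = isGN A

  freeOutsideGN : ℕ → Formula S D → Bool
  freeOutsideGN x topᶠ = false
  freeOutsideGN x botᶠ = false
  freeOutsideGN x (atom p ts) = varInTs x ts
  freeOutsideGN x (A ∧ᶠ B) = not (isGN A ∧ isGN B) ∧ (freeOutsideGN x A ∨ freeOutsideGN x B)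
  freeOutsideGN x (A ∨ᶠ B) = not (isGN A ∧ isGN B) ∧ (freeOutsideGN x A ∨ freeOutsideGN x B)
  freeOutsideGN x (A ⇒ᶠ B) = not (isGN A ∧ isGN B) ∧ (freeOutsideGN x A ∨ freeOutsideGN x B)
  freeOutsideGN x (¬ᶠ A) = false
  freeOutsideGN x (∀ᶠ y A) = not (isGN A) ∧ (if x ≡ᵇ y then false else freeOutsideGN x A)
  freeOutsideGN x (∃ᶠ y A) = not (isGN A) ∧ (if x ≡ᵇ y then false else freeOutsideGN x A)

  -- ∀xA / ∃xA is global iff x occurs free in A and all free occurrences
  -- lie inside GN subformulas; local otherwise.
  isGlobal : ℕ → Formula S D → Bool
  isGlobal x A = freeIn x A ∧ not (freeOutsideGN x A)

  mutual
    substT : ℕ → D → Term S D → Term S D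
    substT x d (var y) = if x ≡ᵇ y then par d else var y
    substT x d (con c) = con c
    substT x d (par e) = par e
    substT x d (fun i ts) = fun i (substTs x d ts)

    substTs : {n : ℕ} → ℕ → D → Vec (Term S D) n → Vec (Term S D) n
    substTs x d [] = []
    substTs x d (t ∷ ts) = substT x d t ∷ substTs x d ts

  subst : ℕ → D → Formula S D → Formula S D
  subst x d topᶠ = topᶠ
  subst x d botᶠ = botᶠ
  subst x d (atom p ts) = atom p (substTs x d ts)
  subst x d (A ∧ᶠ B) = subst x d A ∧ᶠ subst x d B
  subst x d (A ∨ᶠ B) = subst x d A ∨ᶠ subst x d B
  subst x d (A ⇒ᶠ B) = subst x d A ⇒ᶠ subst x d B
  subst x d (¬ᶠ A) = ¬ᶠ subst x d A
  subst x d (∀ᶠ y A) = if x ≡ᵇ y then ∀ᶠ y A else ∀ᶠ y (subst x d A)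
  subst x d (∃ᶠ y A) = if x ≡ᵇ y then ∃ᶠ y A else ∃ᶠ y (subst x d A)

  -- logical size (used as fuel for the forcing recursion)
  size : Formula S D → ℕ
  size topᶠ = 0
  size botᶠ = 0
  size (atom p ts) = 0
  size (A ∧ᶠ B) = suc (size A ⊔ size B)
  size (A ∨ᶠ B) = suc (size A ⊔ size B)
  size (A ⇒ᶠ B) = suc (size A ⊔ size B)
  size (¬ᶠ A) = suc (size A)
  size (∀ᶠ x A) = suc (size A)
  size (∃ᶠ x A) = suc (size A)

  mutual
    data _⊑_ : Term S D → Term S D → Set where
      ⊑-refl : {t : Term S D} → t ⊑ t
      ⊑-fun  : {s : Term S D} {i : ℕ} {ts : Vec (Term S D) (funAr S i)} →
               s ⊑ₛ ts → s ⊑ fun i ts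

    data _⊑ₛ_ : {n : ℕ} → Term S D → Vec (Term S D) n → Set where
      here  : {n : ℕ} {s t : Term S D} {ts : Vec (Term S D) n} → s ⊑ t → s ⊑ₛ (t ∷ ts)
      there : {n : ℕ} {s t : Term S D} {ts : Vec (Term S D) n} → s ⊑ₛ ts → s ⊑ₛ (t ∷ ts)

  -- compositional interpretation J of closed L(D)-terms, J(d̄) = d
  -- (nothing on terms containing variables, i.e. non-closed terms)
  module Interp (cJ : ℕ → D) (fJ : (i : ℕ) → Vec D (funAr S i) → D) where
    mutual
      eval : Term S D → Maybe D
      eval (var x) = nothing
      eval (con c) = just (cJ c)
      eval (par d) = just d
      eval (fun i ts) with evals ts
      ... | just ds = just (fJ i ds)
      ... | nothing = nothing

      evals : {n : ℕ} → Vec (Term S D) n → Maybe (Vec D n)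
      evals [] = just []
      evals (t ∷ ts) with eval t | evals ts
      ... | just d | just ds = just (d ∷ ds)
      ... | _ | _ = nothing

Immediate : {K : Set} → (K → K → Set) → K → K → Set
Immediate {K} _≤_ k k' =
  k ≤ k' × k ≢ k' × ((m : K) → k ≤ m → m ≤ k' → (m ≡ k) ⊎ (m ≡ k'))

record StrictModel (S : Signature) : Set₁ where
  field
    K : Set
    _≤_ : K → K → Set
    ≤-refl : {k : K} → k ≤ k
    ≤-trans : {a b c : K} → a ≤ b → b ≤ c → a ≤ c
    ≤-antisym : {a b : K} → a ≤ b → b ≤ a → a ≡ b
    root : K
    root-≤ : (k : K) → root ≤ k
    preds-linear : {k a b : K} → a ≤ k → b ≤ k → (a ≤ b) ⊎ (b ≤ a)
    finite-height : (k : K) → Σ (List K) (λ ps → (a : K) → a ≤ k → a ∈ ps)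
    countable-branching : (k : K) →
      Σ ((k' : K) → Immediate _≤_ k k' → ℕ)
        (λ g → (a b : K) (p : Immediate _≤_ k a) (q : Immediate _≤_ k b) →
               g a p ≡ g b q → a ≡ b)
    D : Set
    d₀ : D
    cJ : ℕ → D
    fJ : (i : ℕ) → Vec D (funAr S i) → D
    v : K → (p : Pred S) → Vec D (arity p) → Set
    monotone : {k k' : K} (p : Pred S) (ds : Vec D (arity p)) → k ≤ k' → v k p ds → v k' p ds
  open Interp {S} {D} cJ fJ public
  field
    strict : (k : K) (p : Pred S) (ts : Vec (Term S D) (arity p)) (ds : Vec D (arity p)) →
             evals ts ≡ just ds → v k p ds →
             (s : Term S D) → s ⊑ₛ ts → (d : D) → eval s ≡ just d → v k E (d ∷ [])
    finite-verification : (k : K) →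
      Σ (List (Pred S)) (λ ps → (p : Pred S) (ds : Vec D (arity p)) → v k p ds → p ∈ ps)

module _ {S : Signature} (W : StrictModel S) where
  open StrictModel W

  AtomForced : K → (p : Pred S) → Vec (Term S D) (arity p) → Set
  AtomForced k p ts = Σ (Vec D (arity p)) (λ ds → (evals ts ≡ just ds) × v k p ds)

  -- forcing with fuel n (n ≥ size A gives the intended relation)
  Force : ℕ → K → Formula S D → Set
  Force n k topᶠ = ⊤
  Force n k botᶠ = ⊥
  Force n k (atom p ts) = AtomForced k p ts
  Force zero k (A ∧ᶠ B) = ⊥
  Force zero k (A ∨ᶠ B) = ⊥
  Force zero k (A ⇒ᶠ B) = ⊥
  Force zero k (¬ᶠ A) = ⊥
  Force zero k (∀ᶠ x A) = ⊥
  Force zero k (∃ᶠ x A) = ⊥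
  Force (suc n) k (A ∧ᶠ B) = Force n k A × Force n k B
  Force (suc n) k (A ∨ᶠ B) = Force n k A ⊎ Force n k B
  Force (suc n) k (A ⇒ᶠ B) =
    (k' : K) → k ≤ k' → Force n k' A → Σ K (λ k'' → k' ≤ k'' × Force n k'' B)
  Force (suc n) k (¬ᶠ A) = (k' : K) → ¬ Force n k' A
  Force (suc n) k (∀ᶠ x A) =
    if isGlobal x A
    then ((d : D) (k' : K) → k ≤ k' → Force n k' topᶠ →
            Σ K (λ k'' → k' ≤ k'' × Force n k'' (subst x d A)))
    else ((d : D) (k' : K) → k ≤ k' → AtomForced k' E (par d ∷ []) →
            Σ K (λ k'' → k' ≤ k'' × Force n k'' (subst x d A)))
  Force (suc n) k (∃ᶠ x A) =
    if isGlobal x A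
    then Σ D (λ d → Force n k (subst x d A))
    else Σ D (λ d → AtomForced k E (par d ∷ []) × Force n k (subst x d A))

  Forces : K → Formula S D → Set
  Forces k A = Force (size A) k A

  PrevalentFormula : Formula S D → Set
  PrevalentFormula A = (k : K) → Σ K (λ k' → k ≤ k' × Forces k' A)

  Prevalent : Set
  Prevalent =
    ((A : Formula S D) → Closed A → Σ K (λ k → Forces k A) → PrevalentFormula A)
    × ((d : D) → PrevalentFormula (atom E (par d ∷ [])))

-- Write A ↝ A′ when A′ arises from A by replacing one occurrence of ∼ B by ¬ B.
-- By induction on ↝ we show simultaneously: if A is closed and forced at k then A′ is forced
-- at k, and if A′ is forced at k then A is forced at some node above k; the weak converse is
-- what the negative positions (left of ⇒, under ¬) need. At the hole, if k ⊩ ∼ B and some node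
-- forces B, then B, being closed, is prevalent, so some node above k forces B and hence ⊥.
-- Since ¬ B is a GN formula, the replacement can only turn local quantifiers into global ones,
-- and in a prevalent model this is harmless because every E(d̄) holds somewhere above every node.

module Submission where

open import Defs
open import Data.Bool using (true; false; _∧_; _∨_; not; if_then_else_; T; b≤b; f≤t)
  renaming (_≤_ to _≤ᵇ_)
open import Data.Bool.Properties
  using (≤-minimum; ≤-maximum; ≤-reflexive; ∨-identityʳ; ∨-conicalˡ; ∨-conicalʳ)
open import Data.Empty using (⊥-elim)
open import Data.Nat using (ℕ; suc; _≡ᵇ_; _⊔_; s≤s) renaming (_≤_ to _≤ℕ_)
import Data.Nat.Properties as ℕ
open import Data.Product using (Σ; _×_; _,_; proj₁; proj₂)
open import Data.Sum using (inj₁; inj₂)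
open import Data.Unit using (tt)
open import Data.Vec using (Vec; []; _∷_)
open import Relation.Binary.PropositionalEquality as ≡ using (_≡_; refl; cong; cong₂)

∧-mono-≤ : ∀ {a a′ b b′} → a ≤ᵇ a′ → b ≤ᵇ b′ → a ∧ b ≤ᵇ a′ ∧ b′
∧-mono-≤ {b′ = b′} f≤t _ = ≤-minimum b′
∧-mono-≤ {a = false} b≤b _ = b≤b
∧-mono-≤ {a = true}  b≤b q = q

∨-mono-≤ : ∀ {a a′ b b′} → a ≤ᵇ a′ → b ≤ᵇ b′ → a ∨ b ≤ᵇ a′ ∨ b′
∨-mono-≤ {b = b} f≤t _ = ≤-maximum b
∨-mono-≤ {a = false} b≤b q = q
∨-mono-≤ {a = true}  b≤b _ = b≤b

not-antimono-≤ : ∀ {a b} → a ≤ᵇ b → not b ≤ᵇ not a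
not-antimono-≤ f≤t = f≤t
not-antimono-≤ b≤b = b≤b

⊔≤⇒ˡ : ∀ {m n o} → m ⊔ n ≤ℕ o → m ≤ℕ o
⊔≤⇒ˡ = ℕ.m⊔n≤o⇒m≤o _ _

⊔≤⇒ʳ : ∀ {m n o} → m ⊔ n ≤ℕ o → n ≤ℕ o
⊔≤⇒ʳ = ℕ.m⊔n≤o⇒n≤o _ _

if-monoʳ-≤ : ∀ b {c u v} → u ≤ᵇ v → (if b then c else u) ≤ᵇ (if b then c else v)
if-monoʳ-≤ true  _ = b≤b
if-monoʳ-≤ false p = p

module _ {S : Signature} {D : Set} where

  size-subst : ∀ x (d : D) (A : Formula S D) → size (subst x d A) ≡ size A
  size-subst x d topᶠ = refl
  size-subst x d botᶠ = refl
  size-subst x d (atom p ts) = refl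
  size-subst x d (A ∧ᶠ B) = cong suc (cong₂ _⊔_ (size-subst x d A) (size-subst x d B))
  size-subst x d (A ∨ᶠ B) = cong suc (cong₂ _⊔_ (size-subst x d A) (size-subst x d B))
  size-subst x d (A ⇒ᶠ B) = cong suc (cong₂ _⊔_ (size-subst x d A) (size-subst x d B))
  size-subst x d (¬ᶠ A) = cong suc (size-subst x d A)
  size-subst x d (∀ᶠ y A) with x ≡ᵇ y
  ... | true  = refl
  ... | false = cong suc (size-subst x d A)
  size-subst x d (∃ᶠ y A) with x ≡ᵇ y
  ... | true  = refl
  ... | false = cong suc (size-subst x d A)

  size-subst-≤ : ∀ {n} x (d : D) (A : Formula S D) → size A ≤ℕ n → size (subst x d A) ≤ℕ n
  size-subst-≤ x d A = ℕ.≤-trans (ℕ.≤-reflexive (size-subst x d A))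

  mutual
    varInT-substT-self : ∀ x (d : D) (t : Term S D) → varInT x (substT x d t) ≡ false
    varInT-substT-self x d (var y) with x ≡ᵇ y in x≢ᵇy
    ... | true  = refl
    ... | false = x≢ᵇy
    varInT-substT-self x d (con _) = refl
    varInT-substT-self x d (par _) = refl
    varInT-substT-self x d (fun i ts) = varInTs-substTs-self x d ts

    varInTs-substTs-self : ∀ {n} x (d : D) (ts : Vec (Term S D) n) →
                           varInTs x (substTs x d ts) ≡ false
    varInTs-substTs-self x d [] = refl
    varInTs-substTs-self x d (t ∷ ts) =
      cong₂ _∨_ (varInT-substT-self x d t) (varInTs-substTs-self x d ts)

  mutual
    varInT-substT-false : ∀ z x (d : D) (t : Term S D) →
                          varInT z t ≡ false → varInT z (substT x d t) ≡ false
    varInT-substT-false z x d (var y) z∉t with x ≡ᵇ y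
    ... | true  = refl
    ... | false = z∉t
    varInT-substT-false z x d (con _) _ = refl
    varInT-substT-false z x d (par _) _ = refl
    varInT-substT-false z x d (fun i ts) z∉ts = varInTs-substTs-false z x d ts z∉ts

    varInTs-substTs-false : ∀ {n} z x (d : D) (ts : Vec (Term S D) n) →
                            varInTs z ts ≡ false → varInTs z (substTs x d ts) ≡ false
    varInTs-substTs-false z x d [] _ = refl
    varInTs-substTs-false z x d (t ∷ ts) z∉ =
      cong₂ _∨_ (varInT-substT-false z x d t (∨-conicalˡ _ _ z∉))
                (varInTs-substTs-false z x d ts (∨-conicalʳ _ _ z∉))

  freeIn-subst-self : ∀ x (d : D) (A : Formula S D) → freeIn x (subst x d A) ≡ false
  freeIn-subst-self x d topᶠ = refl
  freeIn-subst-self x d botᶠ = refl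
  freeIn-subst-self x d (atom p ts) = varInTs-substTs-self x d ts
  freeIn-subst-self x d (A ∧ᶠ B) = cong₂ _∨_ (freeIn-subst-self x d A) (freeIn-subst-self x d B)
  freeIn-subst-self x d (A ∨ᶠ B) = cong₂ _∨_ (freeIn-subst-self x d A) (freeIn-subst-self x d B)
  freeIn-subst-self x d (A ⇒ᶠ B) = cong₂ _∨_ (freeIn-subst-self x d A) (freeIn-subst-self x d B)
  freeIn-subst-self x d (¬ᶠ A) = freeIn-subst-self x d A
  freeIn-subst-self x d (∀ᶠ y A) with x ≡ᵇ y in x≡ᵇy
  ... | true  rewrite x≡ᵇy = refl
  ... | false rewrite x≡ᵇy = freeIn-subst-self x d A
  freeIn-subst-self x d (∃ᶠ y A) with x ≡ᵇ y in x≡ᵇy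
  ... | true  rewrite x≡ᵇy = refl
  ... | false rewrite x≡ᵇy = freeIn-subst-self x d A

  freeIn-subst-false : ∀ z x (d : D) (A : Formula S D) →
                       freeIn z A ≡ false → freeIn z (subst x d A) ≡ false
  freeIn-subst-false z x d topᶠ _ = refl
  freeIn-subst-false z x d botᶠ _ = refl
  freeIn-subst-false z x d (atom p ts) z∉ = varInTs-substTs-false z x d ts z∉
  freeIn-subst-false z x d (A ∧ᶠ B) z∉ =
    cong₂ _∨_ (freeIn-subst-false z x d A (∨-conicalˡ _ _ z∉))
              (freeIn-subst-false z x d B (∨-conicalʳ _ _ z∉))
  freeIn-subst-false z x d (A ∨ᶠ B) z∉ =
    cong₂ _∨_ (freeIn-subst-false z x d A (∨-conicalˡ _ _ z∉))
              (freeIn-subst-false z x d B (∨-conicalʳ _ _ z∉))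
  freeIn-subst-false z x d (A ⇒ᶠ B) z∉ =
    cong₂ _∨_ (freeIn-subst-false z x d A (∨-conicalˡ _ _ z∉))
              (freeIn-subst-false z x d B (∨-conicalʳ _ _ z∉))
  freeIn-subst-false z x d (¬ᶠ A) z∉ = freeIn-subst-false z x d A z∉
  freeIn-subst-false z x d (∀ᶠ y A) z∉ with x ≡ᵇ y
  ... | true = z∉
  ... | false with z ≡ᵇ y
  ...   | true  = refl
  ...   | false = freeIn-subst-false z x d A z∉
  freeIn-subst-false z x d (∃ᶠ y A) z∉ with x ≡ᵇ y
  ... | true = z∉
  ... | false with z ≡ᵇ y
  ...   | true  = refl
  ...   | false = freeIn-subst-false z x d A z∉

  -- Closed (∀ᶠ y A) and Closed (∃ᶠ y A) unfold to the same type, so this serves both.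
  closed-subst : ∀ y (d : D) (A : Formula S D) → Closed (∀ᶠ y A) → Closed (subst y d A)
  closed-subst y d A closed z with z ≡ᵇ y in z≡y | closed z
  ... | true  | _ rewrite ℕ.≡ᵇ⇒≡ z y (≡.subst T (≡.sym z≡y) tt) = freeIn-subst-self y d A
  ... | false | z∉A = freeIn-subst-false z y d A z∉A

  closedˡ : (A C : Formula S D) → (∀ x → (freeIn x A ∨ freeIn x C) ≡ false) → Closed A
  closedˡ A C closed x = ∨-conicalˡ _ _ (closed x)

  closedʳ : (A C : Formula S D) → (∀ x → (freeIn x A ∨ freeIn x C) ≡ false) → Closed C
  closedʳ A C closed x = ∨-conicalʳ _ _ (closed x)

  infix 4 _↝_

  data _↝_ : Formula S D → Formula S D → Set where
    ∼↝¬ : (B : Formula S D) → ∼ B ↝ ¬ᶠ B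
    ∧ˡ : ∀ {A A′ C} → A ↝ A′ → A ∧ᶠ C ↝ A′ ∧ᶠ C
    ∧ʳ : ∀ {A A′ C} → A ↝ A′ → C ∧ᶠ A ↝ C ∧ᶠ A′
    ∨ˡ : ∀ {A A′ C} → A ↝ A′ → A ∨ᶠ C ↝ A′ ∨ᶠ C
    ∨ʳ : ∀ {A A′ C} → A ↝ A′ → C ∨ᶠ A ↝ C ∨ᶠ A′
    ⇒ˡ : ∀ {A A′ C} → A ↝ A′ → A ⇒ᶠ C ↝ A′ ⇒ᶠ C
    ⇒ʳ : ∀ {A A′ C} → A ↝ A′ → C ⇒ᶠ A ↝ C ⇒ᶠ A′
    ¬ᶠ-cong : ∀ {A A′} → A ↝ A′ → ¬ᶠ A ↝ ¬ᶠ A′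
    ∀ᶠ-cong : ∀ x {A A′} → A ↝ A′ → ∀ᶠ x A ↝ ∀ᶠ x A′
    ∃ᶠ-cong : ∀ x {A A′} → A ↝ A′ → ∃ᶠ x A ↝ ∃ᶠ x A′

  plug-↝ : (F : Ctx S D) (B : Formula S D) → plug F (∼ B) ↝ plug F (¬ᶠ B)
  plug-↝ hole B = ∼↝¬ B
  plug-↝ (binL andᵒ F A) B = ∧ˡ (plug-↝ F B)
  plug-↝ (binL orᵒ F A) B = ∨ˡ (plug-↝ F B)
  plug-↝ (binL impᵒ F A) B = ⇒ˡ (plug-↝ F B)
  plug-↝ (binR andᵒ A F) B = ∧ʳ (plug-↝ F B)
  plug-↝ (binR orᵒ A F) B = ∨ʳ (plug-↝ F B)
  plug-↝ (binR impᵒ A F) B = ⇒ʳ (plug-↝ F B)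
  plug-↝ (negC F) B = ¬ᶠ-cong (plug-↝ F B)
  plug-↝ (allC x F) B = ∀ᶠ-cong x (plug-↝ F B)
  plug-↝ (exC x F) B = ∃ᶠ-cong x (plug-↝ F B)

  ↝-subst : ∀ x (d : D) {A A′} → A ↝ A′ → subst x d A ↝ subst x d A′
  ↝-subst x d (∼↝¬ B) = ∼↝¬ (subst x d B)
  ↝-subst x d (∧ˡ r) = ∧ˡ (↝-subst x d r)
  ↝-subst x d (∧ʳ r) = ∧ʳ (↝-subst x d r)
  ↝-subst x d (∨ˡ r) = ∨ˡ (↝-subst x d r)
  ↝-subst x d (∨ʳ r) = ∨ʳ (↝-subst x d r)
  ↝-subst x d (⇒ˡ r) = ⇒ˡ (↝-subst x d r)
  ↝-subst x d (⇒ʳ r) = ⇒ʳ (↝-subst x d r)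
  ↝-subst x d (¬ᶠ-cong r) = ¬ᶠ-cong (↝-subst x d r)
  ↝-subst x d (∀ᶠ-cong y r) with x ≡ᵇ y
  ... | true  = ∀ᶠ-cong y r
  ... | false = ∀ᶠ-cong y (↝-subst x d r)
  ↝-subst x d (∃ᶠ-cong y r) with x ≡ᵇ y
  ... | true  = ∃ᶠ-cong y r
  ... | false = ∃ᶠ-cong y (↝-subst x d r)

  ↝-size : ∀ {A A′} → A ↝ A′ → size A ≡ size A′
  ↝-size (∼↝¬ B) = cong suc (ℕ.⊔-identityʳ (size B))
  ↝-size (∧ˡ {C = C} r) = cong suc (cong (_⊔ size C) (↝-size r))
  ↝-size (∧ʳ {C = C} r) = cong suc (cong (size C ⊔_) (↝-size r))
  ↝-size (∨ˡ {C = C} r) = cong suc (cong (_⊔ size C) (↝-size r))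
  ↝-size (∨ʳ {C = C} r) = cong suc (cong (size C ⊔_) (↝-size r))
  ↝-size (⇒ˡ {C = C} r) = cong suc (cong (_⊔ size C) (↝-size r))
  ↝-size (⇒ʳ {C = C} r) = cong suc (cong (size C ⊔_) (↝-size r))
  ↝-size (¬ᶠ-cong r) = cong suc (↝-size r)
  ↝-size (∀ᶠ-cong x r) = cong suc (↝-size r)
  ↝-size (∃ᶠ-cong x r) = cong suc (↝-size r)

  ↝-freeIn : ∀ x {A A′} → A ↝ A′ → freeIn x A ≡ freeIn x A′
  ↝-freeIn x (∼↝¬ B) = ∨-identityʳ (freeIn x B)
  ↝-freeIn x (∧ˡ {C = C} r) = cong (_∨ freeIn x C) (↝-freeIn x r)
  ↝-freeIn x (∧ʳ {C = C} r) = cong (freeIn x C ∨_) (↝-freeIn x r)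
  ↝-freeIn x (∨ˡ {C = C} r) = cong (_∨ freeIn x C) (↝-freeIn x r)
  ↝-freeIn x (∨ʳ {C = C} r) = cong (freeIn x C ∨_) (↝-freeIn x r)
  ↝-freeIn x (⇒ˡ {C = C} r) = cong (_∨ freeIn x C) (↝-freeIn x r)
  ↝-freeIn x (⇒ʳ {C = C} r) = cong (freeIn x C ∨_) (↝-freeIn x r)
  ↝-freeIn x (¬ᶠ-cong r) = ↝-freeIn x r
  ↝-freeIn x (∀ᶠ-cong y r) = cong (λ b → if x ≡ᵇ y then false else b) (↝-freeIn x r)
  ↝-freeIn x (∃ᶠ-cong y r) = cong (λ b → if x ≡ᵇ y then false else b) (↝-freeIn x r)

  ↝-isGN-≤ : ∀ {A A′} → A ↝ A′ → isGN A ≤ᵇ isGN A′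
  ↝-isGN-≤ (∼↝¬ B) = ≤-maximum _
  ↝-isGN-≤ (∧ˡ r) = ∧-mono-≤ (↝-isGN-≤ r) b≤b
  ↝-isGN-≤ (∧ʳ r) = ∧-mono-≤ b≤b (↝-isGN-≤ r)
  ↝-isGN-≤ (∨ˡ r) = ∧-mono-≤ (↝-isGN-≤ r) b≤b
  ↝-isGN-≤ (∨ʳ r) = ∧-mono-≤ b≤b (↝-isGN-≤ r)
  ↝-isGN-≤ (⇒ˡ r) = ∧-mono-≤ (↝-isGN-≤ r) b≤b
  ↝-isGN-≤ (⇒ʳ r) = ∧-mono-≤ b≤b (↝-isGN-≤ r)
  ↝-isGN-≤ (¬ᶠ-cong r) = b≤b
  ↝-isGN-≤ (∀ᶠ-cong x r) = ↝-isGN-≤ r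
  ↝-isGN-≤ (∃ᶠ-cong x r) = ↝-isGN-≤ r

  ↝-freeOutsideGN-≥ : ∀ x {A A′} → A ↝ A′ → freeOutsideGN x A′ ≤ᵇ freeOutsideGN x A
  ↝-freeOutsideGN-≥ x (∼↝¬ B) = ≤-minimum _
  ↝-freeOutsideGN-≥ x (∧ˡ {C = C} r) =
    ∧-mono-≤ (not-antimono-≤ (∧-mono-≤ (↝-isGN-≤ r) (b≤b {isGN C})))
             (∨-mono-≤ (↝-freeOutsideGN-≥ x r) (b≤b {freeOutsideGN x C}))
  ↝-freeOutsideGN-≥ x (∧ʳ {C = C} r) =
    ∧-mono-≤ (not-antimono-≤ (∧-mono-≤ (b≤b {isGN C}) (↝-isGN-≤ r)))
             (∨-mono-≤ (b≤b {freeOutsideGN x C}) (↝-freeOutsideGN-≥ x r))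
  ↝-freeOutsideGN-≥ x (∨ˡ {C = C} r) =
    ∧-mono-≤ (not-antimono-≤ (∧-mono-≤ (↝-isGN-≤ r) (b≤b {isGN C})))
             (∨-mono-≤ (↝-freeOutsideGN-≥ x r) (b≤b {freeOutsideGN x C}))
  ↝-freeOutsideGN-≥ x (∨ʳ {C = C} r) =
    ∧-mono-≤ (not-antimono-≤ (∧-mono-≤ (b≤b {isGN C}) (↝-isGN-≤ r)))
             (∨-mono-≤ (b≤b {freeOutsideGN x C}) (↝-freeOutsideGN-≥ x r))
  ↝-freeOutsideGN-≥ x (⇒ˡ {C = C} r) =
    ∧-mono-≤ (not-antimono-≤ (∧-mono-≤ (↝-isGN-≤ r) (b≤b {isGN C})))
             (∨-mono-≤ (↝-freeOutsideGN-≥ x r) (b≤b {freeOutsideGN x C}))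
  ↝-freeOutsideGN-≥ x (⇒ʳ {C = C} r) =
    ∧-mono-≤ (not-antimono-≤ (∧-mono-≤ (b≤b {isGN C}) (↝-isGN-≤ r)))
             (∨-mono-≤ (b≤b {freeOutsideGN x C}) (↝-freeOutsideGN-≥ x r))
  ↝-freeOutsideGN-≥ x (¬ᶠ-cong r) = b≤b
  ↝-freeOutsideGN-≥ x (∀ᶠ-cong y r) =
    ∧-mono-≤ (not-antimono-≤ (↝-isGN-≤ r))
             (if-monoʳ-≤ (x ≡ᵇ y) (↝-freeOutsideGN-≥ x r))
  ↝-freeOutsideGN-≥ x (∃ᶠ-cong y r) =
    ∧-mono-≤ (not-antimono-≤ (↝-isGN-≤ r))
             (if-monoʳ-≤ (x ≡ᵇ y) (↝-freeOutsideGN-≥ x r))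

  ↝-isGlobal-≤ : ∀ x {A A′} → A ↝ A′ → isGlobal x A ≤ᵇ isGlobal x A′
  ↝-isGlobal-≤ x r =
    ∧-mono-≤ (≤-reflexive (↝-freeIn x r)) (not-antimono-≤ (↝-freeOutsideGN-≥ x r))

module Forcing {S : Signature} (W : StrictModel S) where
  open StrictModel W renaming (_≤_ to _≼_; ≤-refl to ≼-refl; ≤-trans to ≼-trans)

  Above : K → (K → Set) → Set
  Above k P = Σ K (λ k′ → k ≼ k′ × P k′)

  above-refl : ∀ {k P} → P k → Above k P
  above-refl p = _ , ≼-refl , p

  above-map : ∀ {k P Q} → (∀ {k′} → k ≼ k′ → P k′ → Q k′) → Above k P → Above k Q
  above-map f (k′ , k≼k′ , p) = k′ , k≼k′ , f k≼k′ p

  infixl 1 _>>=_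

  _>>=_ : ∀ {k P Q} → Above k P → (∀ {k′} → k ≼ k′ → P k′ → Above k′ Q) → Above k Q
  (k′ , k≼k′ , p) >>= f =
    let (k″ , k′≼k″ , q) = f k≼k′ p in k″ , ≼-trans k≼k′ k′≼k″ , q

  AtomForced-mono : ∀ {k k′} p ts → k ≼ k′ → AtomForced W k p ts → AtomForced W k′ p ts
  AtomForced-mono p ts k≼k′ (ds , ts≡ds , holds) = ds , ts≡ds , monotone p ds k≼k′ holds

  Force-mono : ∀ {n k k′} (A : Formula S D) → k ≼ k′ → Force W n k A → Force W n k′ A
  Force-mono topᶠ _ _ = tt
  Force-mono (atom p ts) k≼k′ a = AtomForced-mono p ts k≼k′ a
  Force-mono {suc _} (A ∧ᶠ B) k≼k′ (a , b) = Force-mono A k≼k′ a , Force-mono B k≼k′ b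
  Force-mono {suc _} (A ∨ᶠ B) k≼k′ (inj₁ a) = inj₁ (Force-mono A k≼k′ a)
  Force-mono {suc _} (A ∨ᶠ B) k≼k′ (inj₂ b) = inj₂ (Force-mono B k≼k′ b)
  Force-mono {suc _} (A ⇒ᶠ B) k≼k′ h k″ k′≼k″ = h k″ (≼-trans k≼k′ k′≼k″)
  Force-mono {suc _} (¬ᶠ A) _ h = h
  Force-mono {suc _} (∀ᶠ x A) k≼k′ h with isGlobal x A
  ... | true  = λ d k″ k′≼k″ → h d k″ (≼-trans k≼k′ k′≼k″)
  ... | false = λ d k″ k′≼k″ → h d k″ (≼-trans k≼k′ k′≼k″)
  Force-mono {suc _} (∃ᶠ x A) k≼k′ h with isGlobal x A
  ... | true  = let (d , a) = h in d , Force-mono (subst x d A) k≼k′ a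
  ... | false = let (d , e , a) = h in
                d , AtomForced-mono E (par d ∷ []) k≼k′ e , Force-mono (subst x d A) k≼k′ a

  Force-fuel : ∀ {m n k} (A : Formula S D) → size A ≤ℕ m → size A ≤ℕ n →
               Force W m k A → Force W n k A
  Force-fuel topᶠ _ _ a = a
  Force-fuel (atom p ts) _ _ a = a
  Force-fuel (A ∧ᶠ B) (s≤s p) (s≤s q) (a , b) =
    Force-fuel A (⊔≤⇒ˡ p) (⊔≤⇒ˡ q) a , Force-fuel B (⊔≤⇒ʳ p) (⊔≤⇒ʳ q) b
  Force-fuel (A ∨ᶠ B) (s≤s p) (s≤s q) (inj₁ a) =
    inj₁ (Force-fuel A (⊔≤⇒ˡ p) (⊔≤⇒ˡ q) a)
  Force-fuel (A ∨ᶠ B) (s≤s p) (s≤s q) (inj₂ b) =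
    inj₂ (Force-fuel B (⊔≤⇒ʳ p) (⊔≤⇒ʳ q) b)
  Force-fuel (A ⇒ᶠ B) (s≤s p) (s≤s q) h k′ k≼k′ a =
    above-map (λ _ → Force-fuel B (⊔≤⇒ʳ p) (⊔≤⇒ʳ q))
              (h k′ k≼k′ (Force-fuel A (⊔≤⇒ˡ q) (⊔≤⇒ˡ p) a))
  Force-fuel (¬ᶠ A) (s≤s p) (s≤s q) h k′ a = h k′ (Force-fuel A q p a)
  Force-fuel (∀ᶠ x A) (s≤s p) (s≤s q) h with isGlobal x A
  ... | true  = λ d k′ k≼k′ t →
    above-map (λ _ → Force-fuel (subst x d A) (size-subst-≤ x d A p) (size-subst-≤ x d A q))
              (h d k′ k≼k′ t)
  ... | false = λ d k′ k≼k′ e →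
    above-map (λ _ → Force-fuel (subst x d A) (size-subst-≤ x d A p) (size-subst-≤ x d A q))
              (h d k′ k≼k′ e)
  Force-fuel (∃ᶠ x A) (s≤s p) (s≤s q) h with isGlobal x A
  ... | true  = let (d , a) = h in
    d , Force-fuel (subst x d A) (size-subst-≤ x d A p) (size-subst-≤ x d A q) a
  ... | false = let (d , e , a) = h in
    d , e , Force-fuel (subst x d A) (size-subst-≤ x d A p) (size-subst-≤ x d A q) a

  module _ (prevalent : Prevalent W) where

    E-above : (d : D) (k : K) → Above k (λ k′ → AtomForced W k′ E (par d ∷ []))
    E-above = proj₂ prevalent

    closed-forced-above : ∀ {n k₀} (A : Formula S D) → Closed A → size A ≤ℕ n →
                          Force W n k₀ A → (k : K) → Above k (λ k′ → Force W n k′ A)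
    closed-forced-above A closed p a k =
      above-map (λ _ → Force-fuel A ℕ.≤-refl p)
                (proj₁ prevalent A closed (_ , Force-fuel A p ℕ.≤-refl a) k)

    Force-∀ᶠ-mono : ∀ {n k} x (A A′ : Formula S D) →
      (∀ d {k₀} → Force W n k₀ (subst x d A) →
                  Above k₀ (λ k₁ → Force W n k₁ (subst x d A′))) →
      Force W (suc n) k (∀ᶠ x A) → Force W (suc n) k (∀ᶠ x A′)
    Force-∀ᶠ-mono x A A′ step h with isGlobal x A | isGlobal x A′
    ... | true  | true  = λ d k′ k≼k′ t → h d k′ k≼k′ t >>= λ _ → step d
    ... | false | false = λ d k′ k≼k′ e → h d k′ k≼k′ e >>= λ _ → step d
    ... | true  | false = λ d k′ k≼k′ _ → h d k′ k≼k′ tt >>= λ _ → step d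
    ... | false | true  = λ d k′ k≼k′ _ →
      E-above d k′ >>= λ k′≼k₁ e →
      h d _ (≼-trans k≼k′ k′≼k₁) e >>= λ _ →
      step d

    Force-∃ᶠ-mono : ∀ {n k} x (A A′ : Formula S D) → isGlobal x A ≤ᵇ isGlobal x A′ →
      (∀ d → Force W n k (subst x d A) → Force W n k (subst x d A′)) →
      Force W (suc n) k (∃ᶠ x A) → Force W (suc n) k (∃ᶠ x A′)
    Force-∃ᶠ-mono x A A′ global≤ step h with isGlobal x A | isGlobal x A′ | global≤
    ... | true  | true  | b≤b = let (d , a) = h in d , step d a
    ... | false | false | b≤b = let (d , e , a) = h in d , e , step d a
    ... | false | true  | f≤t = let (d , _ , a) = h in d , step d a

    Force-∃ᶠ-mono-above : ∀ {n k} x (A A′ : Formula S D) →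
      (∀ d → Force W n k (subst x d A) → Above k (λ k₁ → Force W n k₁ (subst x d A′))) →
      Force W (suc n) k (∃ᶠ x A) → Above k (λ k₁ → Force W (suc n) k₁ (∃ᶠ x A′))
    Force-∃ᶠ-mono-above x A A′ step h with isGlobal x A | isGlobal x A′
    ... | true  | true  = let (d , a) = h in above-map (λ _ a′ → d , a′) (step d a)
    ... | false | true  = let (d , _ , a) = h in above-map (λ _ a′ → d , a′) (step d a)
    ... | false | false = let (d , e , a) = h in
      above-map (λ k≼k₁ a′ → d , AtomForced-mono E (par d ∷ []) k≼k₁ e , a′) (step d a)
    ... | true  | false = let (d , a) = h in
      step d a >>= λ _ a′ →
      above-map (λ k₁≼k₂ e → d , e , Force-mono (subst x d A′) k₁≼k₂ a′) (E-above d _)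

    mutual
      ↝-forward : ∀ {n k A A′} → A ↝ A′ → Closed A → size A ≤ℕ n →
                  Force W n k A → Force W n k A′
      ↝-forward {k = k} (∼↝¬ B) closed (s≤s p) h _ b =
        let (k₁ , k≼k₁ , b₁) = closed-forced-above B (closedˡ B botᶠ closed) (⊔≤⇒ˡ p) b k
        in proj₂ (proj₂ (h k₁ k≼k₁ b₁))
      ↝-forward (∧ˡ {A} {C = C} r) closed (s≤s p) (a , c) =
        ↝-forward r (closedˡ A C closed) (⊔≤⇒ˡ p) a , c
      ↝-forward (∧ʳ {A} {C = C} r) closed (s≤s p) (c , a) =
        c , ↝-forward r (closedʳ C A closed) (⊔≤⇒ʳ p) a
      ↝-forward (∨ˡ {A} {C = C} r) closed (s≤s p) (inj₁ a) =
        inj₁ (↝-forward r (closedˡ A C closed) (⊔≤⇒ˡ p) a)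
      ↝-forward (∨ˡ r) _ (s≤s _) (inj₂ c) = inj₂ c
      ↝-forward (∨ʳ r) _ (s≤s _) (inj₁ c) = inj₁ c
      ↝-forward (∨ʳ {A} {C = C} r) closed (s≤s p) (inj₂ a) =
        inj₂ (↝-forward r (closedʳ C A closed) (⊔≤⇒ʳ p) a)
      ↝-forward (⇒ˡ {A} {C = C} r) closed (s≤s p) h k′ k≼k′ a′ =
        ↝-backward r (closedˡ A C closed) (⊔≤⇒ˡ p) a′ >>= λ k′≼k₁ →
        h _ (≼-trans k≼k′ k′≼k₁)
      ↝-forward (⇒ʳ {A} {C = C} r) closed (s≤s p) h k′ k≼k′ c =
        above-map (λ _ → ↝-forward r (closedʳ C A closed) (⊔≤⇒ʳ p)) (h k′ k≼k′ c)
      ↝-forward (¬ᶠ-cong r) closed (s≤s p) h k′ a′ =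
        let (k₁ , _ , a) = ↝-backward r closed p a′ in h k₁ a
      ↝-forward (∀ᶠ-cong x {A} {A′} r) closed (s≤s p) =
        Force-∀ᶠ-mono x A A′ λ d a →
          above-refl (↝-forward (↝-subst x d r) (closed-subst x d A closed) (size-subst-≤ x d A p) a)
      ↝-forward (∃ᶠ-cong x {A} {A′} r) closed (s≤s p) =
        Force-∃ᶠ-mono x A A′ (↝-isGlobal-≤ x r) λ d →
          ↝-forward (↝-subst x d r) (closed-subst x d A closed) (size-subst-≤ x d A p)

      ↝-backward : ∀ {n k A A′} → A ↝ A′ → Closed A → size A ≤ℕ n →
                   Force W n k A′ → Above k (λ k′ → Force W n k′ A)
      ↝-backward (∼↝¬ B) _ (s≤s _) h = above-refl λ k′ _ b → ⊥-elim (h k′ b)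
      ↝-backward (∧ˡ {A} {C = C} r) closed (s≤s p) (a′ , c) =
        above-map (λ k≼k₁ a → a , Force-mono C k≼k₁ c)
                  (↝-backward r (closedˡ A C closed) (⊔≤⇒ˡ p) a′)
      ↝-backward (∧ʳ {A} {C = C} r) closed (s≤s p) (c , a′) =
        above-map (λ k≼k₁ a → Force-mono C k≼k₁ c , a)
                  (↝-backward r (closedʳ C A closed) (⊔≤⇒ʳ p) a′)
      ↝-backward (∨ˡ {A} {C = C} r) closed (s≤s p) (inj₁ a′) =
        above-map (λ _ → inj₁) (↝-backward r (closedˡ A C closed) (⊔≤⇒ˡ p) a′)
      ↝-backward (∨ˡ r) _ (s≤s _) (inj₂ c) = above-refl (inj₂ c)
      ↝-backward (∨ʳ r) _ (s≤s _) (inj₁ c) = above-refl (inj₁ c)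
      ↝-backward (∨ʳ {A} {C = C} r) closed (s≤s p) (inj₂ a′) =
        above-map (λ _ → inj₂) (↝-backward r (closedʳ C A closed) (⊔≤⇒ʳ p) a′)
      ↝-backward (⇒ˡ {A} {C = C} r) closed (s≤s p) h =
        above-refl λ k′ k≼k′ a →
          h k′ k≼k′ (↝-forward r (closedˡ A C closed) (⊔≤⇒ˡ p) a)
      ↝-backward (⇒ʳ {A} {C = C} r) closed (s≤s p) h =
        above-refl λ k′ k≼k′ c →
          h k′ k≼k′ c >>= λ _ → ↝-backward r (closedʳ C A closed) (⊔≤⇒ʳ p)
      ↝-backward (¬ᶠ-cong r) closed (s≤s p) h =
        above-refl λ k′ a → h k′ (↝-forward r closed p a)
      ↝-backward (∀ᶠ-cong x {A} {A′} r) closed (s≤s p) h =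
        above-refl (Force-∀ᶠ-mono x A′ A (λ d →
          ↝-backward (↝-subst x d r) (closed-subst x d A closed) (size-subst-≤ x d A p)) h)
      ↝-backward (∃ᶠ-cong x {A} {A′} r) closed (s≤s p) =
        Force-∃ᶠ-mono-above x A′ A λ d →
          ↝-backward (↝-subst x d r) (closed-subst x d A closed) (size-subst-≤ x d A p)

mainTheorem17 : (S : Signature) (W : StrictModel S) → Prevalent W →
    (k : StrictModel.K W) (F : Ctx S (StrictModel.D W)) (B : Formula S (StrictModel.D W)) →
    Closed (plug F (∼ B)) →
    Forces W k (plug F (∼ B)) →
    Forces W k (plug F (¬ᶠ B))
mainTheorem17 S W prevalent k F B closed forced =
  Force-fuel (plug F (¬ᶠ B)) (ℕ.≤-reflexive (≡.sym (↝-size r))) ℕ.≤-refl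
    (↝-forward prevalent r closed ℕ.≤-refl forced)
  where
    open Forcing W
    r : plug F (∼ B) ↝ plug F (¬ᶠ B)
    r = plug-↝ F B
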